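{- Let $S=(\mathtt v_1,\dots,\mathtt v_m)$, $\mathtt v_i\in\mathbb R^n$. Let $u=(a,\sigma)\in G_{\mathbb R}$, $\ell\in X$ and $v=\ell u$, and set $p=u\cdot 0=-\pi(a)$ and $q=v\cdot 0=\ell\cdot p$. Then $K(u)=K(v)$ if and only if $p$ and $q$ are joined in $\Gamma_S$ by the edge marked $\ell$, i.e.: if $\ell=(e_i-e_j,1)$ then $q=p+\mathtt v_j-\mathtt v_i$ and $(p,\mathtt v_j-\mathtt v_i)=(\mathtt v_i,\mathtt v_j)-|\mathtt v_i|^2$; if $\ell=(-e_i-e_j,-1)$ then $q=\mathtt v_i+\mathtt v_j-p$ and $|p|^2-(p,\mathtt v_i+\mathtt v_j)=-(\mathtt v_i,\mathtt v_j)$.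
   Context: $G_{\mathbb R}$ is the group of pairs $(a,\sigma)$ with $a\in\mathbb R^m$, $\sigma\in\{1,-1\}$, product $(b,\rho)(a,\sigma)=(b+\rho a,\rho\sigma)$. $e_1,\dots,e_m$ is the standard basis of $\mathbb R^m$ and $X=\{(e_i-e_j,1):i\ne j\}\cup\{(-e_i-e_j,-1):i\ne j\}$. $\pi:\mathbb R^m\to\mathbb R^n$ is the linear map $e_i\mapsto\mathtt v_i$, and $G_{\mathbb R}$ acts on $\mathbb R^n$ by $(a,\sigma)\cdot x=-\pi(a)+\sigma x$. The energy is $K(a,\sigma)=\frac{\sigma}{2}\big(|\pi(a)|^2+\sum_i a_i|\mathtt v_i|^2\big)$ for $a=\sum_ia_ie_i$. $\Gamma_S$ is the graph on $\mathbb R^n$ where $p,q$ are joined iff $p,q,\mathtt v_i,\mathtt v_j$ ($i\ne j$) are vertices of a rectangle; the two displayed cases are exactly the adjacent-vertex and opposite-vertex rectangle conditions. -}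

module Defs where

open import Level using (Level; _⊔_)
open import Algebra.Bundles using (CommutativeRing)
open import Data.Nat using (ℕ; zero; suc)
open import Data.Fin using (Fin; zero; suc; _≟_)
open import Data.Product using (_×_; _,_)
open import Relation.Nullary using (yes; no; ¬_)
open import Relation.Binary.PropositionalEquality using (_≡_)

data Sign : Set where
  plus minus : Sign

_·ˢ_ : Sign → Sign → Sign
plus  ·ˢ s = s
minus ·ˢ plus = minus
minus ·ˢ minus = plus

-- The elements of X, indexed by the ordered pair (i , j) with i ≢ j:
--   diff i j  stands for (e_i - e_j , 1)
--   sum  i j  stands for (-e_i - e_j , -1)
data XElem (m : ℕ) : Set where
  diff : (i j : Fin m) → ¬ (i ≡ j) → XElem m
  sum  : (i j : Fin m) → ¬ (i ≡ j) → XElem m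

-- Everything below lives over a commutative ring R (standing in for ℝ).
module Over {c l : Level} (R : CommutativeRing c l) where
  open CommutativeRing R hiding (zero)

  sgn : Sign → Carrier → Carrier
  sgn plus  x = x
  sgn minus x = - x

  Σ : (m : ℕ) → (Fin m → Carrier) → Carrier
  Σ zero    f = 0#
  Σ (suc m) f = f zero + Σ m (λ k → f (suc k))

  Vec : ℕ → Set c
  Vec n = Fin n → Carrier

  _≈ᵛ_ : {n : ℕ} → Vec n → Vec n → Set l
  x ≈ᵛ y = ∀ k → x k ≈ y k

  _+ᵛ_ _-ᵛ_ : {n : ℕ} → Vec n → Vec n → Vec n
  (x +ᵛ y) k = x k + y k
  (x -ᵛ y) k = x k - y k

  -ᵛ_ : {n : ℕ} → Vec n → Vec n
  (-ᵛ x) k = - x k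

  _·_ : {n : ℕ} → Carrier → Vec n → Vec n
  (t · x) k = t * x k

  0ᵛ : {n : ℕ} → Vec n
  0ᵛ k = 0#

  ⟨_,_⟩ : {n : ℕ} → Vec n → Vec n → Carrier
  ⟨_,_⟩ {n} x y = Σ n (λ k → x k * y k)

  ∣_∣² : {n : ℕ} → Vec n → Carrier
  ∣ x ∣² = ⟨ x , x ⟩

  e : {m : ℕ} → Fin m → Vec m
  e i k with k ≟ i
  ... | yes _ = 1#
  ... | no  _ = 0#

  G : ℕ → Set c
  G m = Vec m × Sign

  _∙_ : {m : ℕ} → G m → G m → G m
  (b , ρ) ∙ (a , σ) = (λ k → b k + sgn ρ (a k)) , (ρ ·ˢ σ)

  toG : {m : ℕ} → XElem m → G m
  toG (diff i j _) = (e i -ᵛ e j) , plus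
  toG (sum  i j _) = ((-ᵛ e i) -ᵛ e j) , minus

  Config : ℕ → ℕ → Set c
  Config m n = Fin m → Vec n

  π : {m n : ℕ} → Config m n → Vec m → Vec n
  π {m} S a k = Σ m (λ i → a i * S i k)

  act : {m n : ℕ} → Config m n → G m → Vec n → Vec n
  act S (a , σ) x k = - π S a k + sgn σ (x k)

  -- energy K(a,σ) = σ/2 (|π(a)|^2 + Σ_i a_i |v_i|^2), where `half` is 1/2
  K : {m n : ℕ} → Carrier → Config m n → G m → Carrier
  K {m} half S (a , σ) =
    sgn σ (half * (∣ π S a ∣² + Σ m (λ i → a i * ∣ S i ∣²)))

  MarkedEdge : {m n : ℕ} → Config m n → XElem m → Vec n → Vec n → Set l
  MarkedEdge S (diff i j _) p q =
    (q ≈ᵛ (p +ᵛ (S j -ᵛ S i)))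
    × (⟨ p , S j -ᵛ S i ⟩ ≈ ⟨ S i , S j ⟩ - ∣ S i ∣²)
  MarkedEdge S (sum i j _) p q =
    (q ≈ᵛ ((S i +ᵛ S j) -ᵛ p))
    × (∣ p ∣² - ⟨ p , S i +ᵛ S j ⟩ ≈ - ⟨ S i , S j ⟩)

{-# OPTIONS --safe #-}
-- For ℓ ∈ X the coefficient vector of ℓ u
-- is ±a shifted by ±e_i ± e_j, so by linearity of π, expanding |π(·)|² in K shows that
-- the energy changes by a single inner product (the 1/2 in K cancels the 2 of the
-- expansion):
--   K((e_i - e_j , 1) u)   = K(u) + σ ⟨p - v_i , v_j - v_i⟩,
--   K((-e_i - e_j , -1) u) = K(u) - σ ⟨p - v_i , p - v_j⟩.
-- These vanish exactly when p, q, v_i, v_j form a right angle at v_i, resp. at p,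
-- which is the marked-edge condition; q = ℓ · p because G acts on R^n.
module Submission where

open import Defs
open import Level using (Level)
open import Algebra.Bundles using (CommutativeRing)
open import Algebra.Solver.Ring.AlmostCommutativeRing
  using (fromCommutativeRing; _-Raw-AlmostCommutative⟶_)
open import Data.Nat using (ℕ; zero; suc)
import Data.Nat as ℕ
import Data.Nat.Properties as ℕ
open import Data.Integer.Base as ℤ using (ℤ; +_; -[1+_]; +0; +[1+_]; _⊖_; _◃_; sign; ∣_∣)
import Data.Integer.Properties as ℤ
import Data.Sign.Base as Sign
open import Data.Fin using (Fin; zero; suc; _≟_)
open import Data.Maybe.Base using (Maybe; just; nothing)
open import Data.Product.Base as Product using (_,_; proj₁)
open import Function.Bundles using (_⇔_; mk⇔; Equivalence)
import Function.Properties.Equivalence as ⇔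
open import Relation.Nullary.Decidable using (yes; no)
import Relation.Binary.PropositionalEquality as ≡

-- Algebra.Solver.Ring is parametrised by a coefficient ring mapped into R; the
-- integers with their canonical map serve every commutative ring.

module IntegerCoefficientSolver {c l : Level} (R : CommutativeRing c l) where
  open CommutativeRing R hiding (zero)
  open import Algebra.Properties.Ring ring using (-‿distribˡ-*; -‿distribʳ-*; -‿involutive)
  open import Algebra.Properties.Semiring.Mult semiring using (_×_; ×-homo-+; ×1-homo-*)
  open import Algebra.Properties.AbelianGroup +-abelianGroup using (⁻¹-∙-comm)
  open import Algebra.Properties.Group +-group using (ε⁻¹≈ε)
  open import Algebra.Properties.CommutativeSemigroup +-commutativeSemigroup using (interchange)
  open import Relation.Binary.Reasoning.Setoid setoid

  signed : Sign.Sign → Carrier → Carrier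
  signed Sign.+ x = x
  signed Sign.- x = - x

  fromℤ : ℤ → Carrier
  fromℤ i = signed (sign i) (∣ i ∣ × 1#)

  signed-cong : ∀ s {x y} → x ≈ y → signed s x ≈ signed s y
  signed-cong Sign.+ eq = eq
  signed-cong Sign.- eq = -‿cong eq

  signed-* : ∀ s t x y → signed (s Sign.* t) (x * y) ≈ signed s x * signed t y
  signed-* Sign.+ Sign.+ x y = refl
  signed-* Sign.+ Sign.- x y = -‿distribʳ-* x y
  signed-* Sign.- Sign.+ x y = -‿distribˡ-* x y
  signed-* Sign.- Sign.- x y = begin
    x * y         ≈⟨ -‿involutive (x * y) ⟨
    - - (x * y)   ≈⟨ -‿cong (-‿distribˡ-* x y) ⟩
    - (- x * y)   ≈⟨ -‿distribʳ-* (- x) y ⟩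
    - x * - y     ∎

  fromℤ-◃ : ∀ s n → fromℤ (s ◃ n) ≈ signed s (n × 1#)
  fromℤ-◃ Sign.+ zero    = refl
  fromℤ-◃ Sign.- zero    = sym ε⁻¹≈ε
  fromℤ-◃ Sign.+ (suc n) = refl
  fromℤ-◃ Sign.- (suc n) = refl

  1+x-[1+y]≈x-y : ∀ x y → (1# + x) - (1# + y) ≈ x - y
  1+x-[1+y]≈x-y x y = begin
    (1# + x) + - (1# + y)   ≈⟨ +-congˡ (⁻¹-∙-comm 1# y) ⟨
    (1# + x) + (- 1# + - y) ≈⟨ interchange 1# x (- 1#) (- y) ⟩
    (1# - 1#) + (x - y)     ≈⟨ +-congʳ (-‿inverseʳ 1#) ⟩
    0# + (x - y)            ≈⟨ +-identityˡ _ ⟩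
    x - y                   ∎

  fromℤ-⊖ : ∀ m n → fromℤ (m ⊖ n) ≈ m × 1# - n × 1#
  fromℤ-⊖ zero    zero    = sym (-‿inverseʳ 0#)
  fromℤ-⊖ zero    (suc n) = sym (+-identityˡ _)
  fromℤ-⊖ (suc m) zero    = sym (trans (+-congˡ ε⁻¹≈ε) (+-identityʳ _))
  fromℤ-⊖ (suc m) (suc n) = begin
    fromℤ (suc m ⊖ suc n)    ≡⟨ ≡.cong fromℤ (ℤ.[1+m]⊖[1+n]≡m⊖n m n) ⟩
    fromℤ (m ⊖ n)            ≈⟨ fromℤ-⊖ m n ⟩
    m × 1# - n × 1#          ≈⟨ 1+x-[1+y]≈x-y _ _ ⟨
    suc m × 1# - suc n × 1#  ∎

  fromℤ-homo-+ : ∀ i j → fromℤ (i ℤ.+ j) ≈ fromℤ i + fromℤ j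
  fromℤ-homo-+ (+ m)    (+ n)    = ×-homo-+ 1# m n
  fromℤ-homo-+ (+ m)    -[1+ n ] = fromℤ-⊖ m (suc n)
  fromℤ-homo-+ -[1+ m ] (+ n)    = trans (fromℤ-⊖ n (suc m)) (+-comm _ _)
  fromℤ-homo-+ -[1+ m ] -[1+ n ] = begin
    - (suc (suc (m ℕ.+ n)) × 1#)     ≡⟨ ≡.cong (λ k → - (suc k × 1#)) (ℕ.+-suc m n) ⟨
    - ((suc m ℕ.+ suc n) × 1#)       ≈⟨ -‿cong (×-homo-+ 1# (suc m) (suc n)) ⟩
    - (suc m × 1# + suc n × 1#)      ≈⟨ ⁻¹-∙-comm _ _ ⟨
    - (suc m × 1#) + - (suc n × 1#)  ∎

  fromℤ-homo-* : ∀ i j → fromℤ (i ℤ.* j) ≈ fromℤ i * fromℤ j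
  fromℤ-homo-* i j = begin
    fromℤ (s ◃ ∣ i ∣ ℕ.* ∣ j ∣)               ≈⟨ fromℤ-◃ s (∣ i ∣ ℕ.* ∣ j ∣) ⟩
    signed s ((∣ i ∣ ℕ.* ∣ j ∣) × 1#)       ≈⟨ signed-cong s (×1-homo-* ∣ i ∣ ∣ j ∣) ⟩
    signed s ((∣ i ∣ × 1#) * (∣ j ∣ × 1#))  ≈⟨ signed-* (sign i) (sign j) _ _ ⟩
    fromℤ i * fromℤ j                       ∎
    where s = sign i Sign.* sign j

  fromℤ-homo-neg : ∀ i → fromℤ (ℤ.- i) ≈ - fromℤ i
  fromℤ-homo-neg +0       = sym ε⁻¹≈ε
  fromℤ-homo-neg +[1+ n ] = refl
  fromℤ-homo-neg -[1+ n ] = sym (-‿involutive _)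

  ℤ⟶R : ℤ.+-*-rawRing -Raw-AlmostCommutative⟶ fromCommutativeRing R
  ℤ⟶R = record
    { ⟦_⟧    = fromℤ
    ; +-homo = fromℤ-homo-+
    ; *-homo = fromℤ-homo-*
    ; -‿homo = fromℤ-homo-neg
    ; 0-homo = refl
    ; 1-homo = +-identityʳ 1#
    }

  fromℤ-≟ : ∀ i j → Maybe (fromℤ i ≈ fromℤ j)
  fromℤ-≟ i j with i ℤ.≟ j
  ... | yes i≡j = just (reflexive (≡.cong fromℤ i≡j))
  ... | no  _   = nothing

  open import Algebra.Solver.Ring ℤ.+-*-rawRing (fromCommutativeRing R) ℤ⟶R fromℤ-≟ public

module EdgeEnergy {c l : Level} (R : CommutativeRing c l) where
  open CommutativeRing R hiding (zero)
  open Over R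
  open IntegerCoefficientSolver R using (solve; _:=_; _:+_; _:*_; _:-_; :-_)
  open import Algebra.Properties.Ring ring using (-‿distribˡ-*; -‿involutive)
  open import Algebra.Properties.AbelianGroup +-abelianGroup using (⁻¹-∙-comm)
  open import Algebra.Properties.Group +-group
    using (ε⁻¹≈ε; ⁻¹-injective; identityʳ-unique; x∙y⁻¹≈ε⇒x≈y; x≈y⇒x∙y⁻¹≈ε)
  open import Algebra.Properties.CommutativeSemigroup +-commutativeSemigroup using (interchange)
  open import Relation.Binary.Reasoning.Setoid setoid

  sgn-cong : ∀ σ {x y} → x ≈ y → sgn σ x ≈ sgn σ y
  sgn-cong plus  eq = eq
  sgn-cong minus eq = -‿cong eq

  sgn-0# : ∀ σ → sgn σ 0# ≈ 0#
  sgn-0# plus  = refl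
  sgn-0# minus = ε⁻¹≈ε

  sgn-+ : ∀ σ x y → sgn σ (x + y) ≈ sgn σ x + sgn σ y
  sgn-+ plus  x y = refl
  sgn-+ minus x y = sym (⁻¹-∙-comm x y)

  sgn-neg : ∀ σ x → sgn σ (- x) ≈ - sgn σ x
  sgn-neg plus  x = refl
  sgn-neg minus x = refl

  sgn-*ˡ : ∀ σ x y → sgn σ x * y ≈ sgn σ (x * y)
  sgn-*ˡ plus  x y = refl
  sgn-*ˡ minus x y = sym (-‿distribˡ-* x y)

  sgn-·ˢ : ∀ ρ σ x → sgn (ρ ·ˢ σ) x ≈ sgn ρ (sgn σ x)
  sgn-·ˢ plus  σ     x = refl
  sgn-·ˢ minus plus  x = refl
  sgn-·ˢ minus minus x = sym (-‿involutive x)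

  sgn≈0⇔≈0 : ∀ σ {x} → (sgn σ x ≈ 0#) ⇔ (x ≈ 0#)
  sgn≈0⇔≈0 plus  = ⇔.refl
  sgn≈0⇔≈0 minus = mk⇔ (λ eq → ⁻¹-injective (trans eq (sym ε⁻¹≈ε)))
                        (λ eq → trans (-‿cong eq) ε⁻¹≈ε)

  Σ-cong : ∀ m {f g : Fin m → Carrier} → (∀ k → f k ≈ g k) → Σ m f ≈ Σ m g
  Σ-cong zero    eq = refl
  Σ-cong (suc m) eq = +-cong (eq zero) (Σ-cong m (λ k → eq (suc k)))

  Σ-0# : ∀ m → Σ m (λ _ → 0#) ≈ 0#
  Σ-0# zero    = refl
  Σ-0# (suc m) = trans (+-identityˡ _) (Σ-0# m)

  Σ-distrib-+ : ∀ m (f g : Fin m → Carrier) → Σ m (λ k → f k + g k) ≈ Σ m f + Σ m g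
  Σ-distrib-+ zero    f g = sym (+-identityʳ 0#)
  Σ-distrib-+ (suc m) f g =
    trans (+-congˡ (Σ-distrib-+ m (λ k → f (suc k)) (λ k → g (suc k)))) (interchange _ _ _ _)

  Σ-sgn : ∀ σ m (f : Fin m → Carrier) → Σ m (λ k → sgn σ (f k)) ≈ sgn σ (Σ m f)
  Σ-sgn σ zero    f = sym (sgn-0# σ)
  Σ-sgn σ (suc m) f = trans (+-congˡ (Σ-sgn σ m (λ k → f (suc k)))) (sym (sgn-+ σ _ _))

  Σ-distrib-- : ∀ m (f g : Fin m → Carrier) → Σ m (λ k → f k - g k) ≈ Σ m f - Σ m g
  Σ-distrib-- m f g = trans (Σ-distrib-+ m f _) (+-congˡ (Σ-sgn minus m g))

  Σ-pointwise : ∀ m {f g h l d : Fin m → Carrier} →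
    (∀ k → f k + g k ≈ (h k + l k) + (d k + d k)) →
    Σ m f + Σ m g ≈ (Σ m h + Σ m l) + (Σ m d + Σ m d)
  Σ-pointwise m {f} {g} {h} {l} {d} eq = begin
    Σ m f + Σ m g                              ≈⟨ Σ-distrib-+ m f g ⟨
    Σ m (λ k → f k + g k)                      ≈⟨ Σ-cong m eq ⟩
    Σ m (λ k → (h k + l k) + (d k + d k))      ≈⟨ Σ-distrib-+ m _ _ ⟩
    Σ m (λ k → h k + l k) + Σ m (λ k → d k + d k)
      ≈⟨ +-cong (Σ-distrib-+ m h l) (Σ-distrib-+ m d d) ⟩
    (Σ m h + Σ m l) + (Σ m d + Σ m d)          ∎

  ⟨⟩-cong : ∀ {n} {x x′ y y′ : Vec n} → x ≈ᵛ x′ → y ≈ᵛ y′ → ⟨ x , y ⟩ ≈ ⟨ x′ , y′ ⟩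
  ⟨⟩-cong {n} x≈x′ y≈y′ = Σ-cong n (λ k → *-cong (x≈x′ k) (y≈y′ k))

  ⟨⟩-distribʳ-+ : ∀ {n} (x y z : Vec n) → ⟨ x +ᵛ y , z ⟩ ≈ ⟨ x , z ⟩ + ⟨ y , z ⟩
  ⟨⟩-distribʳ-+ {n} x y z = trans (Σ-cong n (λ k → distribʳ (z k) (x k) (y k))) (Σ-distrib-+ n _ _)

  ⟨⟩-sgnˡ : ∀ {n} σ (x z : Vec n) → ⟨ (λ k → sgn σ (x k)) , z ⟩ ≈ sgn σ ⟨ x , z ⟩
  ⟨⟩-sgnˡ {n} σ x z = trans (Σ-cong n (λ k → sgn-*ˡ σ (x k) (z k))) (Σ-sgn σ n _)

  e-suc : ∀ {m} (i k : Fin m) → e (suc i) (suc k) ≈ e i k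
  e-suc i k with k ≟ i
  ... | yes _ = refl
  ... | no  _ = refl

  ⟨e⟩ : ∀ {m} (i : Fin m) (f : Vec m) → ⟨ e i , f ⟩ ≈ f i
  ⟨e⟩ {suc m} zero f = begin
    1# * f zero + Σ m (λ k → 0# * f (suc k))   ≈⟨ +-cong (*-identityˡ _) (Σ-cong m (λ k → zeroˡ _)) ⟩
    f zero + Σ m (λ _ → 0#)                    ≈⟨ +-congˡ (Σ-0# m) ⟩
    f zero + 0#                                ≈⟨ +-identityʳ _ ⟩
    f zero                                     ∎
  ⟨e⟩ {suc m} (suc i) f = begin
    0# * f zero + Σ m (λ k → e (suc i) (suc k) * f (suc k))  ≈⟨ +-congʳ (zeroˡ _) ⟩
    0# + Σ m (λ k → e (suc i) (suc k) * f (suc k))           ≈⟨ +-identityˡ _ ⟩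
    Σ m (λ k → e (suc i) (suc k) * f (suc k))                ≈⟨ Σ-cong m (λ k → *-congʳ (e-suc i k)) ⟩
    ⟨ e i , (λ k → f (suc k)) ⟩                              ≈⟨ ⟨e⟩ i (λ k → f (suc k)) ⟩
    f (suc i)                                                ∎

  ⟨e-e⟩ : ∀ {m} (i j : Fin m) (f : Vec m) → ⟨ e i -ᵛ e j , f ⟩ ≈ f i - f j
  ⟨e-e⟩ i j f = trans (⟨⟩-distribʳ-+ (e i) _ f)
    (+-cong (⟨e⟩ i f) (trans (⟨⟩-sgnˡ minus (e j) f) (-‿cong (⟨e⟩ j f))))

  ⟨-e-e⟩ : ∀ {m} (i j : Fin m) (f : Vec m) → ⟨ (-ᵛ e i) -ᵛ e j , f ⟩ ≈ - f i - f j
  ⟨-e-e⟩ i j f = trans (⟨⟩-distribʳ-+ (-ᵛ e i) _ f)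
    (+-cong (trans (⟨⟩-sgnˡ minus (e i) f) (-‿cong (⟨e⟩ i f)))
            (trans (⟨⟩-sgnˡ minus (e j) f) (-‿cong (⟨e⟩ j f))))

  ⟨⟩-∙ : ∀ {m} (b a f : Vec m) ρ σ → ⟨ proj₁ ((b , ρ) ∙ (a , σ)) , f ⟩ ≈ ⟨ b , f ⟩ + sgn ρ ⟨ a , f ⟩
  ⟨⟩-∙ b a f ρ σ = trans (⟨⟩-distribʳ-+ b _ f) (+-congˡ (⟨⟩-sgnˡ ρ a f))

  ≈ᵛ-trans : ∀ {n} {x y z : Vec n} → x ≈ᵛ y → y ≈ᵛ z → x ≈ᵛ z
  ≈ᵛ-trans x≈y y≈z k = trans (x≈y k) (y≈z k)

  half-double : ∀ {half} → half + half ≈ 1# → ∀ x → half * (x + x) ≈ x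
  half-double {h} h+h≈1 x = begin
    h * (x + x)    ≈⟨ distribˡ h x x ⟩
    h * x + h * x  ≈⟨ distribʳ x h h ⟨
    (h + h) * x    ≈⟨ *-congʳ h+h≈1 ⟩
    1# * x         ≈⟨ *-identityˡ x ⟩
    x              ∎

  diff-norm-identity : ∀ {n} (x y P : Vec n) →
    ∣ (x -ᵛ y) +ᵛ P ∣² + ∣ x ∣²
      ≈ (∣ P ∣² + ∣ y ∣²) + (⟨ (-ᵛ P) -ᵛ x , y -ᵛ x ⟩ + ⟨ (-ᵛ P) -ᵛ x , y -ᵛ x ⟩)
  diff-norm-identity {n} x y P = Σ-pointwise n (λ k → identity (x k) (y k) (P k))
    where
    identity : ∀ x y P → ((x - y) + P) * ((x - y) + P) + x * x
                           ≈ (P * P + y * y) + ((- P - x) * (y - x) + (- P - x) * (y - x))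
    identity = solve 3 (λ x y P → ((x :- y) :+ P) :* ((x :- y) :+ P) :+ x :* x
                          := (P :* P :+ y :* y) :+ ((:- P :- x) :* (y :- x) :+ (:- P :- x) :* (y :- x))) refl

  sum-norm-identity : ∀ {n} (x y P : Vec n) →
    ∣ P ∣² + ∣ ((-ᵛ x) -ᵛ y) -ᵛ P ∣²
      ≈ (∣ x ∣² + ∣ y ∣²) + (⟨ (-ᵛ P) -ᵛ x , (-ᵛ P) -ᵛ y ⟩ + ⟨ (-ᵛ P) -ᵛ x , (-ᵛ P) -ᵛ y ⟩)
  sum-norm-identity {n} x y P = Σ-pointwise n (λ k → identity (x k) (y k) (P k))
    where
    identity : ∀ x y P → P * P + ((- x - y) - P) * ((- x - y) - P)
                           ≈ (x * x + y * y) + ((- P - x) * (- P - y) + (- P - x) * (- P - y))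
    identity = solve 3 (λ x y P → P :* P :+ ((:- x :- y) :- P) :* ((:- x :- y) :- P)
                          := (x :* x :+ y :* y) :+ ((:- P :- x) :* (:- P :- y) :+ (:- P :- x) :* (:- P :- y))) refl

  ≈⇔sub≈0 : ∀ {x y d} → d ≈ x - y → (x ≈ y) ⇔ (d ≈ 0#)
  ≈⇔sub≈0 {x} {y} d≈x-y = mk⇔ (λ x≈y → trans d≈x-y (x≈y⇒x∙y⁻¹≈ε x≈y))
                              (λ d≈0 → x∙y⁻¹≈ε⇒x≈y x y (trans (sym d≈x-y) d≈0))

  diff-condition⇔ : ∀ {n} (p x y : Vec n) →
    (⟨ p , y -ᵛ x ⟩ ≈ ⟨ x , y ⟩ - ∣ x ∣²) ⇔ (⟨ p -ᵛ x , y -ᵛ x ⟩ ≈ 0#)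
  diff-condition⇔ {n} p x y = ≈⇔sub≈0 (begin
    ⟨ p -ᵛ x , y -ᵛ x ⟩
      ≈⟨ Σ-cong n (λ k → expand (p k) (x k) (y k)) ⟩
    Σ n (λ k → p k * (y k - x k) - (x k * y k - x k * x k))
      ≈⟨ Σ-distrib-- n _ _ ⟩
    ⟨ p , y -ᵛ x ⟩ - Σ n (λ k → x k * y k - x k * x k)
      ≈⟨ +-congˡ (-‿cong (Σ-distrib-- n _ _)) ⟩
    ⟨ p , y -ᵛ x ⟩ - (⟨ x , y ⟩ - ∣ x ∣²) ∎)
    where
    expand : ∀ p x y → (p - x) * (y - x) ≈ p * (y - x) - (x * y - x * x)
    expand = solve 3 (λ p x y → (p :- x) :* (y :- x) := p :* (y :- x) :- (x :* y :- x :* x)) refl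

  sum-condition⇔ : ∀ {n} (p x y : Vec n) →
    (∣ p ∣² - ⟨ p , x +ᵛ y ⟩ ≈ - ⟨ x , y ⟩) ⇔ (⟨ p -ᵛ x , p -ᵛ y ⟩ ≈ 0#)
  sum-condition⇔ {n} p x y = ≈⇔sub≈0 (begin
    ⟨ p -ᵛ x , p -ᵛ y ⟩
      ≈⟨ Σ-cong n (λ k → expand (p k) (x k) (y k)) ⟩
    Σ n (λ k → (p k * p k - p k * (x k + y k)) - - (x k * y k))
      ≈⟨ Σ-distrib-- n _ _ ⟩
    Σ n (λ k → p k * p k - p k * (x k + y k)) - Σ n (λ k → - (x k * y k))
      ≈⟨ +-cong (Σ-distrib-- n _ _) (-‿cong (Σ-sgn minus n _)) ⟩
    (∣ p ∣² - ⟨ p , x +ᵛ y ⟩) - - ⟨ x , y ⟩ ∎)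
    where
    expand : ∀ p x y → (p - x) * (p - y) ≈ (p * p - p * (x + y)) - - (x * y)
    expand = solve 3 (λ p x y → (p :- x) :* (p :- y) := (p :* p :- p :* (x :+ y)) :- :- (x :* y)) refl

  edge-criterion : ∀ {a b} {E : Set a} {C : Set b} {x y d} →
    E → y ≈ x + d → (d ≈ 0#) ⇔ C → (x ≈ y) ⇔ (E Product.× C)
  edge-criterion {x = x} {d = d} edge y≈x+d d≈0⇔C = mk⇔
    (λ x≈y → edge , Equivalence.to d≈0⇔C (identityʳ-unique x d (sym (trans x≈y y≈x+d))))
    (λ (_ , c) → begin
      x       ≈⟨ +-identityʳ x ⟨
      x + 0#  ≈⟨ +-congˡ (Equivalence.from d≈0⇔C c) ⟨
      x + d   ≈⟨ y≈x+d ⟨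
      _       ∎)

  module _ {m n : ℕ} (S : Config m n) where

    π-∙ : ∀ (b a : Vec m) ρ σ →
      π S (proj₁ ((b , ρ) ∙ (a , σ))) ≈ᵛ (λ k → π S b k + sgn ρ (π S a k))
    π-∙ b a ρ σ k = ⟨⟩-∙ b a (λ t → S t k) ρ σ

    act-0ᵛ : ∀ (u : G m) → act S u 0ᵛ ≈ᵛ (-ᵛ π S (proj₁ u))
    act-0ᵛ (a , σ) k = trans (+-congˡ (sgn-0# σ)) (+-identityʳ _)

    act-∙ : ∀ (g h : G m) (x : Vec n) → act S (g ∙ h) x ≈ᵛ act S g (act S h x)
    act-∙ (b , ρ) (a , σ) x k = begin
      - π S (proj₁ ((b , ρ) ∙ (a , σ))) k + sgn (ρ ·ˢ σ) (x k)
        ≈⟨ +-cong (-‿cong (π-∙ b a ρ σ k)) (sgn-·ˢ ρ σ (x k)) ⟩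
      - (B + sgn ρ A) + sgn ρ (sgn σ (x k))
        ≈⟨ regroup B (sgn ρ A) (sgn ρ (sgn σ (x k))) ⟩
      - B + (- sgn ρ A + sgn ρ (sgn σ (x k)))
        ≈⟨ +-congˡ (trans (sgn-+ ρ (- A) (sgn σ (x k))) (+-congʳ (sgn-neg ρ A))) ⟨
      - B + sgn ρ (- A + sgn σ (x k)) ∎
      where
      B = π S b k
      A = π S a k
      regroup : ∀ x y z → - (x + y) + z ≈ - x + (- y + z)
      regroup = solve 3 (λ x y z → :- (x :+ y) :+ z := :- x :+ (:- y :+ z)) refl

    act-diff : ∀ (i j : Fin m) (x : Vec n) → act S ((e i -ᵛ e j) , plus) x ≈ᵛ (x +ᵛ (S j -ᵛ S i))
    act-diff i j x k = trans (+-congʳ (-‿cong (⟨e-e⟩ i j (λ t → S t k)))) (regroup (S i k) (S j k) (x k))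
      where
      regroup : ∀ a b x → - (a - b) + x ≈ x + (b - a)
      regroup = solve 3 (λ a b x → :- (a :- b) :+ x := x :+ (b :- a)) refl

    act-sum : ∀ (i j : Fin m) (x : Vec n) → act S (((-ᵛ e i) -ᵛ e j) , minus) x ≈ᵛ ((S i +ᵛ S j) -ᵛ x)
    act-sum i j x k = trans (+-congʳ (-‿cong (⟨-e-e⟩ i j (λ t → S t k)))) (regroup (S i k) (S j k) (x k))
      where
      regroup : ∀ a b x → - (- a - b) + - x ≈ (a + b) - x
      regroup = solve 3 (λ a b x → :- (:- a :- b) :+ :- x := (a :+ b) :- x) refl

    -- K half S (a , σ) unfolds to sgn σ (half * Q a).
    Q : Vec m → Carrier
    Q a = ∣ π S a ∣² + ⟨ a , (λ i → ∣ S i ∣²) ⟩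

    Q-diff : ∀ (a : Vec m) σ (i j : Fin m) →
      Q (proj₁ (((e i -ᵛ e j) , plus) ∙ (a , σ)))
        ≈ Q a + (⟨ (-ᵛ π S a) -ᵛ S i , S j -ᵛ S i ⟩ + ⟨ (-ᵛ π S a) -ᵛ S i , S j -ᵛ S i ⟩)
    Q-diff a σ i j = begin
      ∣ π S a′ ∣² + ⟨ a′ , sq ⟩
        ≈⟨ +-cong (⟨⟩-cong πa′ πa′) (trans (⟨⟩-∙ _ a sq plus σ) (+-congʳ (⟨e-e⟩ i j sq))) ⟩
      ∣ u ∣² + ((∣ x ∣² - ∣ y ∣²) + A)
        ≈⟨ regroup₁ _ _ _ _ ⟩
      (∣ u ∣² + ∣ x ∣²) + (A - ∣ y ∣²)
        ≈⟨ +-congʳ (diff-norm-identity x y P) ⟩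
      ((∣ P ∣² + ∣ y ∣²) + (D + D)) + (A - ∣ y ∣²)
        ≈⟨ regroup₂ _ _ _ _ ⟩
      (∣ P ∣² + A) + (D + D) ∎
      where
      a′ = proj₁ (((e i -ᵛ e j) , plus) ∙ (a , σ))
      sq = λ t → ∣ S t ∣²
      x = S i
      y = S j
      P = π S a
      A = ⟨ a , sq ⟩
      u = (x -ᵛ y) +ᵛ P
      D = ⟨ (-ᵛ P) -ᵛ x , y -ᵛ x ⟩
      πa′ : π S a′ ≈ᵛ u
      πa′ k = trans (π-∙ _ a plus σ k) (+-congʳ (⟨e-e⟩ i j (λ t → S t k)))
      regroup₁ : ∀ u x y a → u + ((x - y) + a) ≈ (u + x) + (a - y)
      regroup₁ = solve 4 (λ u x y a → u :+ ((x :- y) :+ a) := (u :+ x) :+ (a :- y)) refl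
      regroup₂ : ∀ p y d a → ((p + y) + d) + (a - y) ≈ (p + a) + d
      regroup₂ = solve 4 (λ p y d a → ((p :+ y) :+ d) :+ (a :- y) := (p :+ a) :+ d) refl

    Q-sum : ∀ (a : Vec m) σ (i j : Fin m) →
      Q a + Q (proj₁ ((((-ᵛ e i) -ᵛ e j) , minus) ∙ (a , σ)))
        ≈ ⟨ (-ᵛ π S a) -ᵛ S i , (-ᵛ π S a) -ᵛ S j ⟩ + ⟨ (-ᵛ π S a) -ᵛ S i , (-ᵛ π S a) -ᵛ S j ⟩
    Q-sum a σ i j = begin
      (∣ P ∣² + A) + (∣ π S a′ ∣² + ⟨ a′ , sq ⟩)
        ≈⟨ +-congˡ (+-cong (⟨⟩-cong πa′ πa′)
                           (trans (⟨⟩-∙ _ a sq minus σ) (+-congʳ (⟨-e-e⟩ i j sq)))) ⟩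
      (∣ P ∣² + A) + (∣ w ∣² + ((- ∣ x ∣² - ∣ y ∣²) - A))
        ≈⟨ regroup₁ _ _ _ _ _ ⟩
      (∣ P ∣² + ∣ w ∣²) - (∣ x ∣² + ∣ y ∣²)
        ≈⟨ +-congʳ (sum-norm-identity x y P) ⟩
      ((∣ x ∣² + ∣ y ∣²) + (D + D)) - (∣ x ∣² + ∣ y ∣²)
        ≈⟨ regroup₂ _ _ ⟩
      D + D ∎
      where
      a′ = proj₁ ((((-ᵛ e i) -ᵛ e j) , minus) ∙ (a , σ))
      sq = λ t → ∣ S t ∣²
      x = S i
      y = S j
      P = π S a
      A = ⟨ a , sq ⟩
      w = ((-ᵛ x) -ᵛ y) -ᵛ P
      D = ⟨ (-ᵛ P) -ᵛ x , (-ᵛ P) -ᵛ y ⟩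
      πa′ : π S a′ ≈ᵛ w
      πa′ k = trans (π-∙ _ a minus σ k) (+-congʳ (⟨-e-e⟩ i j (λ t → S t k)))
      regroup₁ : ∀ p a w x y → (p + a) + (w + ((- x - y) - a)) ≈ (p + w) - (x + y)
      regroup₁ = solve 5 (λ p a w x y → (p :+ a) :+ (w :+ ((:- x :- y) :- a)) := (p :+ w) :- (x :+ y)) refl
      regroup₂ : ∀ s d → (s + d) - s ≈ d
      regroup₂ = solve 2 (λ s d → (s :+ d) :- s := d) refl

    module _ {half : Carrier} (half+half≈1 : half + half ≈ 1#) where

      K-diff : ∀ (a : Vec m) σ (i j : Fin m) →
        K half S (((e i -ᵛ e j) , plus) ∙ (a , σ))
          ≈ K half S (a , σ) + sgn σ ⟨ act S (a , σ) 0ᵛ -ᵛ S i , S j -ᵛ S i ⟩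
      K-diff a σ i j = begin
        sgn σ (half * Q a′)
          ≈⟨ sgn-cong σ (*-congˡ (Q-diff a σ i j)) ⟩
        sgn σ (half * (Q a + (D + D)))
          ≈⟨ sgn-cong σ (trans (distribˡ half (Q a) (D + D)) (+-congˡ (half-double half+half≈1 D))) ⟩
        sgn σ (half * Q a + D)
          ≈⟨ sgn-+ σ _ _ ⟩
        sgn σ (half * Q a) + sgn σ D
          ≈⟨ +-congˡ (sgn-cong σ (⟨⟩-cong -πa≈p (λ _ → refl))) ⟩
        sgn σ (half * Q a) + sgn σ ⟨ act S (a , σ) 0ᵛ -ᵛ S i , S j -ᵛ S i ⟩ ∎
        where
        a′ = proj₁ (((e i -ᵛ e j) , plus) ∙ (a , σ))
        D = ⟨ (-ᵛ π S a) -ᵛ S i , S j -ᵛ S i ⟩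
        -πa≈p : ((-ᵛ π S a) -ᵛ S i) ≈ᵛ (act S (a , σ) 0ᵛ -ᵛ S i)
        -πa≈p k = +-congʳ (sym (act-0ᵛ (a , σ) k))

      K-sum : ∀ (a : Vec m) σ (i j : Fin m) →
        K half S ((((-ᵛ e i) -ᵛ e j) , minus) ∙ (a , σ))
          ≈ K half S (a , σ) - sgn σ ⟨ act S (a , σ) 0ᵛ -ᵛ S i , act S (a , σ) 0ᵛ -ᵛ S j ⟩
      K-sum a σ i j = begin
        sgn (minus ·ˢ σ) (half * Q a′)      ≈⟨ sgn-·ˢ minus σ _ ⟩
        - sgn σ (half * Q a′)               ≈⟨ sgn-neg σ _ ⟨
        sgn σ (- (half * Q a′))             ≈⟨ sgn-cong σ half-Q-sum ⟩
        sgn σ (half * Q a - D)              ≈⟨ sgn-+ σ _ _ ⟩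
        sgn σ (half * Q a) + sgn σ (- D)    ≈⟨ +-congˡ (sgn-neg σ D) ⟩
        sgn σ (half * Q a) - sgn σ D        ≈⟨ +-congˡ (-‿cong (sgn-cong σ (⟨⟩-cong -πa≈p -πa≈p))) ⟩
        sgn σ (half * Q a) - sgn σ ⟨ act S (a , σ) 0ᵛ -ᵛ S i , act S (a , σ) 0ᵛ -ᵛ S j ⟩ ∎
        where
        a′ = proj₁ ((((-ᵛ e i) -ᵛ e j) , minus) ∙ (a , σ))
        D = ⟨ (-ᵛ π S a) -ᵛ S i , (-ᵛ π S a) -ᵛ S j ⟩
        -πa≈p : ∀ {x} → ((-ᵛ π S a) -ᵛ x) ≈ᵛ (act S (a , σ) 0ᵛ -ᵛ x)
        -πa≈p k = +-congʳ (sym (act-0ᵛ (a , σ) k))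
        regroup : ∀ h q q′ → - (h * q′) ≈ h * q - h * (q + q′)
        regroup = solve 3 (λ h q q′ → :- (h :* q′) := h :* q :- h :* (q :+ q′)) refl
        half-Q-sum : - (half * Q a′) ≈ half * Q a - D
        half-Q-sum = begin
          - (half * Q a′)                   ≈⟨ regroup half (Q a) (Q a′) ⟩
          half * Q a - half * (Q a + Q a′)  ≈⟨ +-congˡ (-‿cong (*-congˡ (Q-sum a σ i j))) ⟩
          half * Q a - half * (D + D)       ≈⟨ +-congˡ (-‿cong (half-double half+half≈1 D)) ⟩
          half * Q a - D                    ∎

mainTheorem4 : {c l : Level} (R : CommutativeRing c l)
    → let open CommutativeRing R in
      let open Over R in
      (half : Carrier) → half + half ≈ 1#
    → (m n : ℕ) (S : Config m n) (u : G m) (ℓ : XElem m)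
    → let v = toG ℓ ∙ u
          p = act S u 0ᵛ
          q = act S v 0ᵛ
      in (K half S u ≈ K half S v) ⇔ MarkedEdge S ℓ p q
mainTheorem4 R half half+half≈1 m n S (a , σ) (diff i j i≢j) =
  edge-criterion
    (≈ᵛ-trans (act-∙ S (toG (diff i j i≢j)) (a , σ) 0ᵛ) (act-diff S i j _))
    (K-diff S half+half≈1 a σ i j)
    (⇔.trans (sgn≈0⇔≈0 σ) (⇔.sym (diff-condition⇔ _ (S i) (S j))))
  where open Over R; open EdgeEnergy R
mainTheorem4 R half half+half≈1 m n S (a , σ) (sum i j i≢j) =
  edge-criterion
    (≈ᵛ-trans (act-∙ S (toG (sum i j i≢j)) (a , σ) 0ᵛ) (act-sum S i j _))
    (K-sum S half+half≈1 a σ i j)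
    (⇔.trans (sgn≈0⇔≈0 minus) (⇔.trans (sgn≈0⇔≈0 σ) (⇔.sym (sum-condition⇔ _ (S i) (S j)))))
  where open Over R; open EdgeEnergy R
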